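{- Let $a,b,k$ be integers with $k\ge b>a\ge1$. For $m\ge1$ let $\mathcal{BD}'_{a,b,k}(m)$ be the set of partitions $\lambda=(\lambda_1,\dots,\lambda_m)$ with exactly $m$ parts, all congruent to $a$ or $b$ modulo $k$, such that $\lambda_m\in\{a,b\}$ and for $1\le i<m$: $\lambda_i-\lambda_{i+1}\ge k$ with strict inequality if $\lambda_i\equiv a\pmod k$, and $\lambda_i-\lambda_{i+1}\le 2k$ with strict inequality if $\lambda_{i+1}\equiv b\pmod k$. For $m\ge 2$ and $0\le h\le m-2$ let $\mathcal{BD}'_{a,b,k}(m,h,a)$ (resp. $\mathcal{BD}'_{a,b,k}(m,h,b)$) be the set of $\lambda\in\mathcal{BD}'_{a,b,k}(m)$ with largest part $k(h+1)+k(m-1)+a$ (resp. $kh+k(m-1)+b$). Then for $m\ge2$ and $0\le h\le m-2$, \[\sum_{\lambda\in\mathcal{BD}'_{a,b,k}(m,h,a)}u^{\ell_a(\lambda)}v^{\ell_b(\lambda)}q^{|\lambda|}=(uq^a+vq^b)u^{h+1}v^{m-h-2}q^{k\binom m2+k\binom{h+1}2+(m-1)b+(k-b+a)(h+1)}{{m-2}\brack h}_k,\] \[\sum_{\lambda\in\mathcal{BD}'_{a,b,k}(m,h,b)}u^{\ell_a(\lambda)}v^{\ell_b(\lambda)}q^{|\lambda|}=(uq^a+vq^b)u^{h}v^{m-h-1}q^{k\binom m2+k\binom{h+1}2+(m-1)b+(k-b+a)h}{{m-2}\brack h}_k.\]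
   Context: A partition is a finite non-increasing sequence of positive integers; $|\lambda|$ is the sum of its parts; $\ell_a(\lambda)$, $\ell_b(\lambda)$ are the numbers of parts congruent to $a$, resp. $b$, modulo $k$. $(x;q)_n=\prod_{i=0}^{n-1}(1-xq^i)$, and ${A\brack B}_k=\frac{(q^k;q^k)_A}{(q^k;q^k)_B(q^k;q^k)_{A-B}}$ for $A\ge B\ge0$, $0$ otherwise. -}

module Defs where

open import Level using (Level)
open import Data.Nat using (ℕ; zero; suc; _+_; _*_; _∸_; _≤_; _<_; NonZero; _≟_; _≤?_; _<?_)
open import Data.Nat.DivMod using (_%_)
open import Data.List using (List; []; _∷_; length; filter; map; foldr; concatMap; upTo; head; last)
open import Data.List.Relation.Unary.All using (All; all?)
open import Data.List.Relation.Unary.Linked using (Linked; []; [-]; _∷_)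
open import Data.Maybe using (Maybe; just)
import Data.Maybe.Properties as MP
open import Data.Product using (_×_; _,_)
open import Data.Sum using (_⊎_)
open import Relation.Binary.PropositionalEquality using (_≡_)
open import Relation.Binary.Core using (Rel)
open import Relation.Nullary using (Dec; yes; no; ¬_)
open import Relation.Nullary.Decidable using (_×-dec_; _⊎-dec_; _→-dec_)
open import Relation.Unary using (Pred; Decidable)
open import Algebra.Bundles using (CommutativeRing)
import Algebra.Bundles
import Algebra.Definitions.RawSemiring as RS

linked? : ∀ {R : Rel ℕ Level.zero} → (∀ x y → Dec (R x y)) → (xs : List ℕ) → Dec (Linked R xs)
linked? R? [] = yes []
linked? R? (x ∷ []) = yes [-]
linked? R? (x ∷ y ∷ xs) with R? x y | linked? R? (y ∷ xs)
... | yes p | yes q = yes (p ∷ q)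
... | no ¬p | _     = no λ { (p ∷ _) → ¬p p }
... | yes _ | no ¬q = no λ { (_ ∷ q) → ¬q q }

module _ (a b k : ℕ) {{_ : NonZero k}} where

  _≡ₖ_ : ℕ → ℕ → Set
  x ≡ₖ y = x % k ≡ y % k

  Gap : Rel ℕ Level.zero
  Gap x y = (k + y ≤ x) × ((x ≡ₖ a) → k + y < x)
          × (x ≤ 2 * k + y) × ((y ≡ₖ b) → x < 2 * k + y)

  BD′ : ℕ → List ℕ → Set
  BD′ m λs = (length λs ≡ m)
           × All (λ x → 1 ≤ x) λs
           × Linked (λ x y → y ≤ x) λs
           × All (λ x → (x ≡ₖ a) ⊎ (x ≡ₖ b)) λs
           × ((last λs ≡ just a) ⊎ (last λs ≡ just b))
           × Linked Gap λs

  BD′max : ℕ → ℕ → List ℕ → Set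
  BD′max m N λs = BD′ m λs × (head λs ≡ just N)

  ≡ₖ? : ∀ x y → Dec (x ≡ₖ y)
  ≡ₖ? x y = (x % k) ≟ (y % k)

  gap? : ∀ x y → Dec (Gap x y)
  gap? x y = ((k + y) ≤? x) ×-dec ((≡ₖ? x a →-dec (k + y) <? x)
           ×-dec ((x ≤? (2 * k + y)) ×-dec (≡ₖ? y b →-dec x <? (2 * k + y))))

  BD′max? : ∀ m N → Decidable (BD′max m N)
  BD′max? m N λs =
    ((length λs ≟ m)
    ×-dec (all? (λ x → 1 ≤? x) λs
    ×-dec (linked? (λ x y → y ≤? x) λs
    ×-dec (all? (λ x → ≡ₖ? x a ⊎-dec ≡ₖ? x b) λs
    ×-dec ((MP.≡-dec _≟_ (last λs) (just a) ⊎-dec MP.≡-dec _≟_ (last λs) (just b))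
    ×-dec linked? gap? λs)))))
    ×-dec MP.≡-dec _≟_ (head λs) (just N)

  ℓa ℓb : List ℕ → ℕ
  ℓa λs = length (filter (λ x → ≡ₖ? x a) λs)
  ℓb λs = length (filter (λ x → ≡ₖ? x b) λs)

  size : List ℕ → ℕ
  size = foldr _+_ 0

-- Enumeration: all lists of length m with entries in {0, …, N}.
-- Every partition with largest part N and m parts occurs exactly once.

lists : ℕ → ℕ → List (List ℕ)
lists N zero    = [] ∷ []
lists N (suc m) = concatMap (λ x → map (x ∷_) (lists N m)) (upTo (suc N))

module _ {c ℓ} (R : CommutativeRing c ℓ) where
  open CommutativeRing R using (Carrier; 0#; 1#; _-_; semiring) renaming (_+_ to _+ᵣ_; _*_ to _*ᵣ_)
  open RS (Algebra.Bundles.Semiring.rawSemiring semiring) using (_^_)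

  ∑ : List Carrier → Carrier
  ∑ = foldr _+ᵣ_ 0#

  ∏ : List Carrier → Carrier
  ∏ = foldr _*ᵣ_ 1#

  poch : Carrier → Carrier → ℕ → Carrier
  poch x y n = ∏ (map (λ i → 1# - x *ᵣ (y ^ i)) (upTo n))

  qfac : Carrier → ℕ → ℕ → Carrier
  qfac q k n = poch (q ^ k) (q ^ k) n

  genBD : (a b k : ℕ) {{_ : NonZero k}} → (m N : ℕ) → Carrier → Carrier → Carrier → Carrier
  genBD a b k m N u v q =
    ∑ (map (λ λs → (u ^ ℓa a b k λs) *ᵣ (v ^ ℓb a b k λs) *ᵣ (q ^ size a b k λs))
           (filter (BD′max? a b k m N) (lists N m)))

{-# OPTIONS --safe #-}
module Submission where

-- Call t·k + a the part of kind A at level t, and t·k + b the part of kind B at level t.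
-- Between such parts, the gap conditions of BD′ say exactly that a part of kind A at level t
-- is followed by one of either kind at level t − 2, and a part of kind B by one at level
-- t − 1; the last part lies at level 0. So the generating function f m κ t of the partitions
-- with m parts whose largest part has kind κ and level t satisfies
-- f (m + 1) κ t = w κ · Q^t · (f m A t′ + f m B t′) with t′ = t − descent κ and f 1 κ 0 = w κ,
-- where w A = u q^a, w B = v q^b, Q = q^k. With h parts of kind A and j of kind B above the
-- last part, the largest part lies at level 2h + j, and σ (1 + h + j) (2h + j), where
-- σ m t = f m A t + f m B t, obeys the q-Pascal recursion. Its closed form is
-- (w A + w B) (w A)^h (w B)^j Q^(C(h+j+1,2) + C(h+1,2)) [h+j, h]_Q; the theorem is one more
-- step of the recursion, and multiplying by (Q;Q)_h (Q;Q)_j clears the q-binomial's denominator.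

open import Defs
open import Level using (Level)
open import Data.Nat using (ℕ; NonZero; _≤_; _<_; _∸_)
import Data.Nat as N
open import Data.Nat.Combinatorics using (_C_)
open import Data.Product using (_×_)
open import Algebra.Bundles using (CommutativeRing)
import Algebra.Bundles
import Algebra.Definitions.RawSemiring as RS

open import Data.Nat using (zero; suc; z≤n; s≤s; s≤s⁻¹)
import Data.Nat.Properties as ℕ
open import Data.Nat.Combinatorics using (nC1≡n; nCk+nC[k+1]≡[n+1]C[k+1])
open import Data.Nat.DivMod using (_%_; _/_; [m+kn]%n≡m%n; m<n⇒m%n≡m; n%n≡0; m≡m%n+[m/n]*n)
open import Data.Nat.Tactic.RingSolver using (solve-∀)
open import Data.Fin using (Fin; toℕ)
import Data.Fin.Properties as Fin
open import Data.List using (List; []; _∷_; [_]; map; filter; concatMap; _++_; _∷ʳ_; applyUpTo; upTo; foldr; length; last)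
import Data.List.Properties as List
open import Data.List.Relation.Unary.All using (All; []; _∷_)
open import Data.List.Relation.Unary.Linked using ([-]; _∷_)
open import Data.List.Relation.Unary.Linked.Properties using (Linked⇒All)
open import Data.Maybe using (just)
import Data.Maybe.Properties as Maybe
open import Data.Product using (_,_; Σ; proj₁; proj₂)
open import Data.Sum using (_⊎_; inj₁; inj₂)
open import Function using (_∘_; _⇔_; mk⇔; Equivalence)
open import Relation.Nullary using (¬_; Dec; yes; no; contradiction)
open import Relation.Nullary.Decidable using (_×-dec_; _⊎-dec_)
open import Relation.Unary using (Pred; Decidable)
open import Relation.Binary.PropositionalEquality as ≡ using (_≡_; _≢_)
open import Algebra.Bundles using (Monoid)

data Kind : Set where
  A B : Kind

descent : Kind → ℕ
descent A = 2
descent B = 1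

module _ where
  open import Data.Nat using (_+_; _*_)
  open ≡.≡-Reasoning

  C₂-suc : ∀ n → suc n C 2 ≡ n + n C 2
  C₂-suc n = ≡.trans (≡.sym (nCk+nC[k+1]≡[n+1]C[k+1] n 1)) (≡.cong (_+ n C 2) (nC1≡n n))

  qExponent : ℕ → ℕ → ℕ
  qExponent h j = suc (h + j) C 2 + suc h C 2

  qExponent-sucˡ : ∀ h j → suc h + (suc h + j) + qExponent h j ≡ qExponent (suc h) j
  qExponent-sucˡ h j = begin
    suc h + (suc h + j) + (suc (h + j) C 2 + suc h C 2)  ≡⟨ regroup (suc h) j (suc (h + j) C 2) (suc h C 2) ⟩
    (suc h + j + suc (h + j) C 2) + (suc h + suc h C 2) ≡⟨ ≡.cong₂ _+_ (C₂-suc (suc h + j)) (C₂-suc (suc h)) ⟨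
    qExponent (suc h) j                                  ∎
    where
    regroup : ∀ m j X Y → m + (m + j) + (X + Y) ≡ (m + j + X) + (m + Y)
    regroup = solve-∀

  qExponent-sucʳ : ∀ h j → suc (h + j) + qExponent h j ≡ qExponent h (suc j)
  qExponent-sucʳ h j = begin
    suc (h + j) + (suc (h + j) C 2 + suc h C 2)  ≡⟨ ℕ.+-assoc (suc (h + j)) _ _ ⟨
    suc (h + j) + suc (h + j) C 2 + suc h C 2    ≡⟨ ≡.cong (_+ suc h C 2) (C₂-suc (suc (h + j))) ⟨
    suc (suc (h + j)) C 2 + suc h C 2            ≡⟨ ≡.cong (λ n → suc n C 2 + suc h C 2) (ℕ.+-suc h j) ⟨
    qExponent h (suc j)                          ∎

module _ {c ℓ} (M : Monoid c ℓ) where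
  open Monoid M

  foldr-++ : ∀ xs ys → foldr _∙_ ε (xs ++ ys) ≈ foldr _∙_ ε xs ∙ foldr _∙_ ε ys
  foldr-++ []       ys = sym (identityˡ _)
  foldr-++ (x ∷ xs) ys = trans (∙-congˡ (foldr-++ xs ys)) (sym (assoc _ _ _))

module RingSums {c ℓ} (R : CommutativeRing c ℓ) where
  open CommutativeRing R
  open import Algebra.Properties.Semiring.Sum semiring
    using (sum; sum-syntax; sum-cong-≋; sum-cong-≗; sum-replicate-zero; ∑-distrib-+)
  open import Relation.Binary.Reasoning.Setoid setoid

  indicator : ∀ {p} {P : Set p} → Dec P → Carrier → Carrier
  indicator (yes _) x = x
  indicator (no _)  _ = 0#

  module _ {p} {P : Set p} where

    indicator-yes : (P? : Dec P) → P → ∀ x → indicator P? x ≈ x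
    indicator-yes (yes _) _ _ = refl
    indicator-yes (no ¬p) p _ = contradiction p ¬p

    indicator-no : (P? : Dec P) → ¬ P → ∀ x → indicator P? x ≈ 0#
    indicator-no (yes p) ¬p _ = contradiction p ¬p
    indicator-no (no _)  _  _ = refl

    indicator-cong : (P? : Dec P) → ∀ {x y} → x ≈ y → indicator P? x ≈ indicator P? y
    indicator-cong (yes _) x≈y = x≈y
    indicator-cong (no _)  _   = refl

    indicator-*ˡ : (P? : Dec P) → ∀ w x → indicator P? (w * x) ≈ w * indicator P? x
    indicator-*ˡ (yes _) w x = refl
    indicator-*ˡ (no _)  w x = sym (zeroʳ w)

    indicator-⇔ : ∀ {q} {Q : Set q} (P? : Dec P) (Q? : Dec Q) → P ⇔ Q → ∀ x → indicator P? x ≈ indicator Q? x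
    indicator-⇔ (yes _) (yes _) _   _ = refl
    indicator-⇔ (no _)  (no _)  _   _ = refl
    indicator-⇔ (yes p) (no ¬q) P⇔Q _ = contradiction (Equivalence.to P⇔Q p) ¬q
    indicator-⇔ (no ¬p) (yes q) P⇔Q _ = contradiction (Equivalence.from P⇔Q q) ¬p

    indicator-× : ∀ {q} {Q : Set q} (P? : Dec P) (Q? : Dec Q) x →
                  indicator (P? ×-dec Q?) x ≈ indicator P? (indicator Q? x)
    indicator-× (yes _) (yes _) _ = refl
    indicator-× (yes _) (no _)  _ = refl
    indicator-× (no _)  _       _ = refl

  sum-zero : ∀ {n} (t : Fin n → Carrier) → (∀ i → t i ≈ 0#) → sum t ≈ 0#
  sum-zero {n} t t≈0 = trans (sum-cong-≋ t≈0) (sum-replicate-zero n)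

  ∑-point : ∀ n (f : ℕ → Carrier) {y} → y < n → (∀ i → i ≢ y → f i ≈ 0#) →
            ∑[ i < n ] f (toℕ i) ≈ f y
  ∑-point (suc n) f {zero} _ f≈0 = begin
    f 0 + ∑[ i < n ] f (suc (toℕ i)) ≈⟨ +-congˡ (sum-zero {n} _ (λ i → f≈0 (suc (toℕ i)) λ ())) ⟩
    f 0 + 0#                         ≈⟨ +-identityʳ _ ⟩
    f 0                              ∎
  ∑-point (suc n) f {suc y} (s≤s y<n) f≈0 = begin
    f 0 + ∑[ i < n ] f (suc (toℕ i)) ≈⟨ +-cong (f≈0 0 λ ()) (∑-point n (f ∘ suc) y<n f∘suc≈0) ⟩
    0# + f (suc y)                   ≈⟨ +-identityˡ _ ⟩
    f (suc y)                        ∎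
    where
    f∘suc≈0 : ∀ i → i ≢ y → f (suc i) ≈ 0#
    f∘suc≈0 i i≢y = f≈0 (suc i) (i≢y ∘ ℕ.suc-injective)

  ∑-two-points : ∀ n (f : ℕ → Carrier) {y z} → y ≢ z → y < n → z < n →
                 (∀ i → i ≢ y → i ≢ z → f i ≈ 0#) →
                 ∑[ i < n ] f (toℕ i) ≈ f y + f z
  ∑-two-points n f {y} {z} y≢z y<n z<n f≈0 = begin
    ∑[ i < n ] f (toℕ i)
      ≈⟨ sum-cong-≋ {n} (λ i → split (toℕ i)) ⟩
    ∑[ i < n ] (only y (toℕ i) + only z (toℕ i))
      ≈⟨ ∑-distrib-+ {n} (only y ∘ toℕ) (only z ∘ toℕ) ⟩
    ∑[ i < n ] only y (toℕ i) + ∑[ i < n ] only z (toℕ i)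
      ≈⟨ +-cong (∑-point n (only y) y<n (off y)) (∑-point n (only z) z<n (off z)) ⟩
    only y y + only z z
      ≈⟨ +-cong (indicator-yes (y ℕ.≟ y) ≡.refl (f y)) (indicator-yes (z ℕ.≟ z) ≡.refl (f z)) ⟩
    f y + f z ∎
    where
    only : ℕ → ℕ → Carrier
    only y i = indicator (i ℕ.≟ y) (f i)
    off : ∀ y i → i ≢ y → only y i ≈ 0#
    off y i i≢y = indicator-no (i ℕ.≟ y) i≢y (f i)
    split : ∀ i → f i ≈ only y i + only z i
    split i with i ℕ.≟ y | i ℕ.≟ z
    ... | yes ≡.refl | yes ≡.refl = contradiction ≡.refl y≢z
    ... | yes _      | no _       = sym (+-identityʳ _)
    ... | no _       | yes _      = sym (+-identityˡ _)
    ... | no i≢y     | no i≢z     = trans (f≈0 i i≢y i≢z) (sym (+-identityʳ 0#))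

  ∑-truncate : ∀ n d (f : ℕ → Carrier) → (∀ i → n ≤ i → f i ≈ 0#) →
               ∑[ i < n N.+ d ] f (toℕ i) ≈ ∑[ i < n ] f (toℕ i)
  ∑-truncate zero    d f f≈0 = sum-zero {d} _ (λ i → f≈0 (toℕ i) z≤n)
  ∑-truncate (suc n) d f f≈0 = +-congˡ (∑-truncate n d (f ∘ suc) (λ i n≤i → f≈0 (suc i) (s≤s n≤i)))

  module _ {a} {A : Set a} where

    ∑-map-cong : ∀ {f g : A → Carrier} → (∀ x → f x ≈ g x) → ∀ xs → ∑ R (map f xs) ≈ ∑ R (map g xs)
    ∑-map-cong f≈g []       = refl
    ∑-map-cong f≈g (x ∷ xs) = +-cong (f≈g x) (∑-map-cong f≈g xs)

    ∑-map-zero : ∀ {f : A → Carrier} → (∀ x → f x ≈ 0#) → ∀ xs → ∑ R (map f xs) ≈ 0#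
    ∑-map-zero f≈0 xs = trans (∑-map-cong f≈0 xs) (zeros xs)
      where
      zeros : ∀ xs → ∑ R (map (λ _ → 0#) xs) ≈ 0#
      zeros []       = refl
      zeros (_ ∷ xs) = trans (+-congˡ (zeros xs)) (+-identityʳ 0#)

    ∑-map-*ˡ : ∀ w (f : A → Carrier) xs → w * ∑ R (map f xs) ≈ ∑ R (map (λ x → w * f x) xs)
    ∑-map-*ˡ w f []       = zeroʳ w
    ∑-map-*ˡ w f (x ∷ xs) = trans (distribˡ w _ _) (+-congˡ (∑-map-*ˡ w f xs))

    ∑-map-indicator : ∀ {p} {P : Set p} (P? : Dec P) (f : A → Carrier) xs →
                      indicator P? (∑ R (map f xs)) ≈ ∑ R (map (indicator P? ∘ f) xs)
    ∑-map-indicator (yes _) f xs = refl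
    ∑-map-indicator (no _)  f xs = sym (∑-map-zero (λ _ → refl) xs)

    ∑-filter : ∀ {p} {P : Pred A p} (P? : Decidable P) (f : A → Carrier) xs →
               ∑ R (map f (filter P? xs)) ≈ ∑ R (map (λ x → indicator (P? x) (f x)) xs)
    ∑-filter P? f []       = refl
    ∑-filter P? f (x ∷ xs) with P? x
    ... | yes _ = +-congˡ (∑-filter P? f xs)
    ... | no _  = trans (∑-filter P? f xs) (sym (+-identityˡ _))

    ∑-applyUpTo : ∀ (f : A → Carrier) (g : ℕ → A) n →
                  ∑ R (map f (applyUpTo g n)) ≡ ∑[ i < n ] f (g (toℕ i))
    ∑-applyUpTo f g zero    = ≡.refl
    ∑-applyUpTo f g (suc n) = ≡.cong (f (g 0) +_) (∑-applyUpTo f (g ∘ suc) n)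

    ∑-concatMap : ∀ {b} {B : Set b} (f : B → Carrier) (F : A → List B) xs →
                  ∑ R (map f (concatMap F xs)) ≈ ∑ R (map (λ x → ∑ R (map f (F x))) xs)
    ∑-concatMap f F []       = refl
    ∑-concatMap f F (x ∷ xs) = begin
      ∑ R (map f (F x ++ concatMap F xs))              ≡⟨ ≡.cong (∑ R) (List.map-++ f (F x) (concatMap F xs)) ⟩
      ∑ R (map f (F x) ++ map f (concatMap F xs))      ≈⟨ foldr-++ +-monoid (map f (F x)) _ ⟩
      ∑ R (map f (F x)) + ∑ R (map f (concatMap F xs)) ≈⟨ +-congˡ (∑-concatMap f F xs) ⟩
      ∑ R (map f (F x)) + ∑ R (map (λ x → ∑ R (map f (F x))) xs) ∎

  ∑-lists-suc : ∀ N m (g : List ℕ → Carrier) →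
                ∑ R (map g (lists N (suc m))) ≈ ∑[ x < suc N ] ∑ R (map (λ l → g (toℕ x ∷ l)) (lists N m))
  ∑-lists-suc N m g = begin
    ∑ R (map g (concatMap (λ x → map (x ∷_) (lists N m)) (upTo (suc N))))
      ≈⟨ ∑-concatMap g (λ x → map (x ∷_) (lists N m)) (upTo (suc N)) ⟩
    ∑ R (map (λ x → ∑ R (map g (map (x ∷_) (lists N m)))) (upTo (suc N)))
      ≡⟨ ∑-applyUpTo _ (λ x → x) (suc N) ⟩
    ∑[ x < suc N ] ∑ R (map g (map (toℕ x ∷_) (lists N m)))
      ≡⟨ sum-cong-≗ {suc N} (λ x → ≡.cong (∑ R) (≡.sym (List.map-∘ {g = g} {f = toℕ x ∷_} (lists N m)))) ⟩
    ∑[ x < suc N ] ∑ R (map (λ l → g (toℕ x ∷ l)) (lists N m)) ∎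

  ∑-lists-truncate : ∀ N d m (g : List ℕ → Carrier) → (∀ l → ¬ All (_≤ N) l → g l ≈ 0#) →
                     ∑ R (map g (lists (N N.+ d) m)) ≈ ∑ R (map g (lists N m))
  ∑-lists-truncate N d zero    g g≈0 = refl
  ∑-lists-truncate N d (suc m) g g≈0 = begin
    ∑ R (map g (lists (N N.+ d) (suc m)))
      ≈⟨ ∑-lists-suc (N N.+ d) m g ⟩
    ∑[ x < suc N N.+ d ] ∑ R (map (λ l → g (toℕ x ∷ l)) (lists (N N.+ d) m))
      ≈⟨ sum-cong-≋ {suc N N.+ d} (λ x → ∑-lists-truncate N d m _ (tail-unbounded (toℕ x))) ⟩
    ∑[ x < suc N N.+ d ] ∑ R (map (λ l → g (toℕ x ∷ l)) (lists N m))
      ≈⟨ ∑-truncate (suc N) d _ (λ x N<x → ∑-map-zero (head-unbounded x N<x) (lists N m)) ⟩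
    ∑[ x < suc N ] ∑ R (map (λ l → g (toℕ x ∷ l)) (lists N m))
      ≈⟨ sym (∑-lists-suc N m g) ⟩
    ∑ R (map g (lists N (suc m))) ∎
    where
    tail-unbounded : ∀ x l → ¬ All (_≤ N) l → g (x ∷ l) ≈ 0#
    tail-unbounded x l ¬l≤N = g≈0 (x ∷ l) λ { (_ ∷ l≤N) → ¬l≤N l≤N }
    head-unbounded : ∀ x → N < x → ∀ l → g (x ∷ l) ≈ 0#
    head-unbounded x N<x l = g≈0 (x ∷ l) λ { (x≤N ∷ _) → ℕ.<⇒≱ N<x x≤N }

module GaussianBinomial {c ℓ} (R : CommutativeRing c ℓ) (Q : CommutativeRing.Carrier R) where
  open CommutativeRing R
  open RS (Algebra.Bundles.Semiring.rawSemiring semiring) using (_^_)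
  open import Algebra.Properties.Semiring.Exp semiring using (^-homo-*)
  open import Algebra.Properties.Ring ring using (-‿distribʳ-*)
  open import Algebra.Solver.Ring.NaturalCoefficients.Default commutativeSemiring
  open import Relation.Binary.Reasoning.Setoid setoid

  -- qBinomial h j is the Gaussian binomial coefficient [h + j, h]_Q.
  qBinomial : ℕ → ℕ → Carrier
  qBinomial zero    _       = 1#
  qBinomial (suc h) zero    = 1#
  qBinomial (suc h) (suc j) = qBinomial h (suc j) + Q ^ suc h * qBinomial (suc h) j

  qBinomial-zeroʳ : ∀ h → qBinomial h 0 ≡ 1#
  qBinomial-zeroʳ zero    = ≡.refl
  qBinomial-zeroʳ (suc h) = ≡.refl

  [Q]! : ℕ → Carrier
  [Q]! = poch R Q Q

  poch-suc : ∀ n → [Q]! (suc n) ≈ [Q]! n * (1# - Q ^ suc n)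
  poch-suc n = begin
    ∏ R (map f (upTo (suc n)))         ≡⟨ ≡.cong (∏ R ∘ map f) (≡.sym (List.upTo-∷ʳ n)) ⟩
    ∏ R (map f (upTo n ∷ʳ n))          ≡⟨ ≡.cong (∏ R) (List.map-++ f (upTo n) [ n ]) ⟩
    ∏ R (map f (upTo n) ++ [ f n ])    ≈⟨ foldr-++ *-monoid (map f (upTo n)) [ f n ] ⟩
    ∏ R (map f (upTo n)) * (f n * 1#)  ≈⟨ *-congˡ (*-identityʳ (f n)) ⟩
    ∏ R (map f (upTo n)) * f n         ∎
    where
    f : ℕ → Carrier
    f i = 1# - Q * Q ^ i

  1-x+x[1-y]≈1-xy : ∀ x y → (1# - x) + x * (1# - y) ≈ 1# - x * y
  1-x+x[1-y]≈1-xy x y = begin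
    (1# - x) + x * (1# - y)    ≈⟨ +-congˡ x[1-y]≈x-xy ⟩
    (1# - x) + (x - x * y)     ≈⟨ +-assoc 1# (- x) _ ⟩
    1# + (- x + (x - x * y))   ≈⟨ +-congˡ (sym (+-assoc (- x) x _)) ⟩
    1# + ((- x + x) - x * y)   ≈⟨ +-congˡ (trans (+-congʳ (-‿inverseˡ x)) (+-identityˡ _)) ⟩
    1# - x * y                 ∎
    where
    x[1-y]≈x-xy : x * (1# - y) ≈ x - x * y
    x[1-y]≈x-xy = trans (distribˡ x 1# (- y)) (+-cong (*-identityʳ x) (sym (-‿distribʳ-* x y)))

  qBinomial-poch : ∀ h j → qBinomial h j * [Q]! h * [Q]! j ≈ [Q]! (h N.+ j)
  qBinomial-poch zero    j       = trans (*-congʳ (*-identityˡ 1#)) (*-identityˡ _)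
  qBinomial-poch (suc h) zero    = begin
    1# * [Q]! (suc h) * 1#  ≈⟨ trans (*-identityʳ _) (*-identityˡ _) ⟩
    [Q]! (suc h)            ≡⟨ ≡.cong [Q]! (ℕ.+-identityʳ (suc h)) ⟨
    [Q]! (suc h N.+ 0)      ∎
  qBinomial-poch (suc h) (suc j) = begin
    (B₁ + X * B₂) * [Q]! (suc h) * [Q]! (suc j)
      ≈⟨ solve 5 (λ B₁ B₂ X P₁ P₂ → (B₁ :+ X :* B₂) :* P₁ :* P₂ := B₁ :* P₁ :* P₂ :+ X :* (B₂ :* P₁ :* P₂))
                 refl B₁ B₂ X ([Q]! (suc h)) ([Q]! (suc j)) ⟩
    B₁ * [Q]! (suc h) * [Q]! (suc j) + X * (B₂ * [Q]! (suc h) * [Q]! (suc j))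
      ≈⟨ +-cong (*-congʳ (*-congˡ (poch-suc h))) (*-congˡ (*-congˡ (poch-suc j))) ⟩
    B₁ * ([Q]! h * (1# - X)) * [Q]! (suc j) + X * (B₂ * [Q]! (suc h) * ([Q]! j * (1# - Y)))
      ≈⟨ solve 9 (λ B₁ B₂ X P₁ P₂ P₃ P₄ X′ Y′ →
                    B₁ :* (P₁ :* X′) :* P₂ :+ X :* (B₂ :* P₃ :* (P₄ :* Y′))
                    := (B₁ :* P₁ :* P₂) :* X′ :+ X :* ((B₂ :* P₃ :* P₄) :* Y′)) refl
                  B₁ B₂ X ([Q]! h) ([Q]! (suc j)) ([Q]! (suc h)) ([Q]! j) (1# - X) (1# - Y) ⟩
    (B₁ * [Q]! h * [Q]! (suc j)) * (1# - X) + X * ((B₂ * [Q]! (suc h) * [Q]! j) * (1# - Y))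
      ≈⟨ +-cong (*-congʳ (qBinomial-poch h (suc j))) (*-congˡ (*-congʳ (qBinomial-poch (suc h) j))) ⟩
    [Q]! (h N.+ suc j) * (1# - X) + X * ([Q]! (suc h N.+ j) * (1# - Y))
      ≡⟨ ≡.cong (λ n → [Q]! n * (1# - X) + X * ([Q]! (suc h N.+ j) * (1# - Y))) (ℕ.+-suc h j) ⟩
    F * (1# - X) + X * (F * (1# - Y))
      ≈⟨ solve 4 (λ F X X′ Y′ → F :* X′ :+ X :* (F :* Y′) := F :* (X′ :+ X :* Y′)) refl F X (1# - X) (1# - Y) ⟩
    F * ((1# - X) + X * (1# - Y))
      ≈⟨ *-congˡ (1-x+x[1-y]≈1-xy X Y) ⟩
    F * (1# - X * Y)
      ≈⟨ *-congˡ (+-congˡ (-‿cong (sym (^-homo-* Q (suc h) (suc j))))) ⟩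
    F * (1# - Q ^ (suc h N.+ suc j))
      ≡⟨ ≡.cong (λ n → F * (1# - Q ^ suc n)) (ℕ.+-suc h j) ⟩
    F * (1# - Q ^ suc (suc (h N.+ j)))
      ≈⟨ sym (poch-suc (suc (h N.+ j))) ⟩
    [Q]! (suc (suc (h N.+ j)))
      ≡⟨ ≡.cong (λ n → [Q]! (suc n)) (ℕ.+-suc h j) ⟨
    [Q]! (suc h N.+ suc j) ∎
    where
    B₁ = qBinomial h (suc j)
    B₂ = qBinomial (suc h) j
    X = Q ^ suc h
    Y = Q ^ suc j
    F = [Q]! (suc (h N.+ j))

module SolveRecurrence {c ℓ} (R : CommutativeRing c ℓ) where
  open CommutativeRing R
  open RS (Algebra.Bundles.Semiring.rawSemiring semiring) using (_^_)
  open import Algebra.Properties.Semiring.Exp semiring using (^-homo-*)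
  open import Algebra.Solver.Ring.NaturalCoefficients.Default commutativeSemiring
  open import Relation.Binary.Reasoning.Setoid setoid
  open GaussianBinomial R using (qBinomial; qBinomial-zeroʳ; qBinomial-poch)

  record Recurrence (Q : Carrier) (w : Kind → Carrier) (f : ℕ → Kind → ℕ → Carrier) : Set ℓ where
    field
      f-one-zero : ∀ κ → f 1 κ 0 ≈ w κ
      f-one-suc  : ∀ κ t → f 1 κ (suc t) ≈ 0#
      f-low      : ∀ n κ t → t < descent κ → f (2 N.+ n) κ t ≈ 0#
      f-step     : ∀ n κ s → f (2 N.+ n) κ (descent κ N.+ s)
                             ≈ w κ * Q ^ (descent κ N.+ s) * (f (suc n) A s + f (suc n) B s)

  module Solution {Q w f} (recurrence : Recurrence Q w f) where
    open Recurrence recurrence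

    σ : ℕ → ℕ → Carrier
    σ n t = f n A t + f n B t

    f-step′ : ∀ n κ {s t} → t ≡ descent κ N.+ s → f (2 N.+ n) κ t ≈ w κ * Q ^ t * σ (suc n) s
    f-step′ n κ {s} ≡.refl = f-step n κ s

    f-vanish : ∀ n κ t → (∀ s → t ≡ descent κ N.+ s → σ (suc n) s ≈ 0#) → f (2 N.+ n) κ t ≈ 0#
    f-vanish n κ t σ≈0 with t ℕ.<? descent κ
    ... | yes t<d = f-low n κ t t<d
    ... | no t≮d  = begin
      f (2 N.+ n) κ t            ≈⟨ f-step′ n κ t≡d+s ⟩
      w κ * Q ^ t * σ (suc n) s  ≈⟨ *-congˡ (σ≈0 s t≡d+s) ⟩
      w κ * Q ^ t * 0#           ≈⟨ zeroʳ _ ⟩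
      0#                         ∎
      where
      s = t ∸ descent κ
      t≡d+s = ≡.sym (ℕ.m+[n∸m]≡n (ℕ.≮⇒≥ t≮d))

    private
      descend : ∀ κ {n s t} → t ≡ descent κ N.+ s → t < suc n ⊎ suc n N.+ suc n < t → s < n ⊎ n N.+ n < s
      descend A         ≡.refl (inj₁ (s≤s t<n))         = inj₁ (ℕ.<⇒≤ t<n)
      descend B         ≡.refl (inj₁ (s≤s t<n))         = inj₁ t<n
      descend A {n} {s} ≡.refl (inj₂ (s≤s (s≤s 2n<t))) = inj₂ (≡.subst (_≤ s) (ℕ.+-suc n n) 2n<t)
      descend B {n} {s} ≡.refl (inj₂ (s≤s 2n<t))       = inj₂ (ℕ.<⇒≤ (≡.subst (_≤ s) (≡.cong suc (ℕ.+-suc n n)) 2n<t))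

    σ-vanish : ∀ n t → t < n ⊎ n N.+ n < t → σ (suc n) t ≈ 0#
    σ-vanish zero    (suc t) (inj₂ _) = trans (+-cong (f-one-suc A t) (f-one-suc B t)) (+-identityʳ 0#)
    σ-vanish (suc n) t       out      =
      trans (+-cong (f-vanish n A t (λ s t≡ → σ-vanish n s (descend A t≡ out)))
                    (f-vanish n B t (λ s t≡ → σ-vanish n s (descend B t≡ out))))
            (+-identityʳ 0#)

    x y : Carrier
    x = w A
    y = w B

    Φ : ℕ → ℕ → Carrier
    Φ h j = σ (suc (h N.+ j)) (h N.+ (h N.+ j))

    closed : ℕ → ℕ → ℕ → Carrier → Carrier
    closed h j e G = (x + y) * x ^ h * y ^ j * Q ^ e * G

    closed-x : ∀ t h j e G → x * Q ^ t * closed h j e G ≈ closed (suc h) j (t N.+ e) G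
    closed-x t h j e G = begin
      x * Q ^ t * ((x + y) * x ^ h * y ^ j * Q ^ e * G)
        ≈⟨ solve 7 (λ x y Qᵗ xʰ yʲ Qᵉ G → x :* Qᵗ :* ((x :+ y) :* xʰ :* yʲ :* Qᵉ :* G)
                                          := (x :+ y) :* (x :* xʰ) :* yʲ :* (Qᵗ :* Qᵉ) :* G)
                   refl x y (Q ^ t) (x ^ h) (y ^ j) (Q ^ e) G ⟩
      (x + y) * (x * x ^ h) * y ^ j * (Q ^ t * Q ^ e) * G
        ≈⟨ *-congʳ (*-congˡ (sym (^-homo-* Q t e))) ⟩
      (x + y) * x ^ suc h * y ^ j * Q ^ (t N.+ e) * G ∎

    closed-y : ∀ t h j e G → y * Q ^ t * closed h j e G ≈ closed h (suc j) (t N.+ e) G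
    closed-y t h j e G = begin
      y * Q ^ t * ((x + y) * x ^ h * y ^ j * Q ^ e * G)
        ≈⟨ solve 7 (λ x y Qᵗ xʰ yʲ Qᵉ G → y :* Qᵗ :* ((x :+ y) :* xʰ :* yʲ :* Qᵉ :* G)
                                          := (x :+ y) :* xʰ :* (y :* yʲ) :* (Qᵗ :* Qᵉ) :* G)
                   refl x y (Q ^ t) (x ^ h) (y ^ j) (Q ^ e) G ⟩
      (x + y) * x ^ h * (y * y ^ j) * (Q ^ t * Q ^ e) * G
        ≈⟨ *-congʳ (*-congˡ (sym (^-homo-* Q t e))) ⟩
      (x + y) * x ^ h * y ^ suc j * Q ^ (t N.+ e) * G ∎

    closed-+ : ∀ h j e d G₁ G₂ → closed h j e G₁ + closed h j (e N.+ d) G₂ ≈ closed h j e (G₁ + Q ^ d * G₂)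
    closed-+ h j e d G₁ G₂ = begin
      M * Q ^ e * G₁ + M * Q ^ (e N.+ d) * G₂    ≈⟨ +-congˡ (*-congʳ (*-congˡ (^-homo-* Q e d))) ⟩
      M * Q ^ e * G₁ + M * (Q ^ e * Q ^ d) * G₂  ≈⟨ solve 5 (λ M Qᵉ Qᵈ G₁ G₂ → M :* Qᵉ :* G₁ :+ M :* (Qᵉ :* Qᵈ) :* G₂
                                                                := M :* Qᵉ :* (G₁ :+ Qᵈ :* G₂))
                                                     refl M (Q ^ e) (Q ^ d) G₁ G₂ ⟩
      M * Q ^ e * (G₁ + Q ^ d * G₂)              ∎
      where M = (x + y) * x ^ h * y ^ j

    Φ-closed : ∀ h j → Φ h j ≈ closed h j (qExponent h j) (qBinomial Q h j)
    Φ-closed zero zero = begin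
      f 1 A 0 + f 1 B 0                 ≈⟨ +-cong (f-one-zero A) (f-one-zero B) ⟩
      x + y                             ≈⟨ solve 2 (λ x y → x :+ y := (x :+ y) :* con 1 :* con 1 :* con 1 :* con 1) refl x y ⟩
      (x + y) * 1# * 1# * 1# * 1#       ∎
    Φ-closed (suc h) zero = begin
      f (2 N.+ (h N.+ 0)) A t + f (2 N.+ (h N.+ 0)) B t
        ≈⟨ +-cong (f-step′ (h N.+ 0) A (≡.cong suc (ℕ.+-suc h (h N.+ 0))))
                  (f-vanish (h N.+ 0) B t beyond) ⟩
      x * Q ^ t * Φ h 0 + 0#
        ≈⟨ +-identityʳ _ ⟩
      x * Q ^ t * Φ h 0
        ≈⟨ *-congˡ (Φ-closed h 0) ⟩
      x * Q ^ t * closed h 0 (qExponent h 0) (qBinomial Q h 0)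
        ≈⟨ closed-x t h 0 _ _ ⟩
      closed (suc h) 0 (t N.+ qExponent h 0) (qBinomial Q h 0)
        ≡⟨ ≡.cong₂ (closed (suc h) 0) (qExponent-sucˡ h 0) (qBinomial-zeroʳ Q h) ⟩
      closed (suc h) 0 (qExponent (suc h) 0) 1# ∎
      where
      t = suc h N.+ (suc h N.+ 0)
      beyond : ∀ s → t ≡ descent B N.+ s → σ (suc (h N.+ 0)) s ≈ 0#
      beyond s ≡.refl = σ-vanish (h N.+ 0) s (inj₂ (ℕ.≤-reflexive (top h)))
        where
        top : ∀ h → suc (h N.+ 0 N.+ (h N.+ 0)) ≡ h N.+ suc (h N.+ 0)
        top = solve-∀
    Φ-closed zero (suc j) = begin
      f (2 N.+ j) A (suc j) + f (2 N.+ j) B (suc j)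
        ≈⟨ +-cong (f-vanish j A (suc j) below) (f-step j B j) ⟩
      0# + y * Q ^ suc j * Φ 0 j
        ≈⟨ +-identityˡ _ ⟩
      y * Q ^ suc j * Φ 0 j
        ≈⟨ *-congˡ (Φ-closed 0 j) ⟩
      y * Q ^ suc j * closed 0 j (qExponent 0 j) 1#
        ≈⟨ closed-y (suc j) 0 j _ _ ⟩
      closed 0 (suc j) (suc j N.+ qExponent 0 j) 1#
        ≡⟨ ≡.cong (λ e → closed 0 (suc j) e 1#) (qExponent-sucʳ 0 j) ⟩
      closed 0 (suc j) (qExponent 0 (suc j)) 1# ∎
      where
      below : ∀ s → suc j ≡ descent A N.+ s → σ (suc j) s ≈ 0#
      below s 1+j≡2+s = σ-vanish j s (inj₁ (ℕ.≤-reflexive (≡.sym (ℕ.suc-injective 1+j≡2+s))))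
    Φ-closed (suc h) (suc j) = begin
      f (2 N.+ n) A t + f (2 N.+ n) B t
        ≈⟨ +-cong (f-step′ n A (≡.cong suc (ℕ.+-suc h (h N.+ suc j))))
                  (f-step n B (h N.+ suc (h N.+ suc j))) ⟩
      x * Q ^ t * Φ h (suc j) + y * Q ^ t * σ (suc (h N.+ suc j)) (h N.+ suc (h N.+ suc j))
        ≡⟨ ≡.cong₂ (λ n′ s′ → x * Q ^ t * Φ h (suc j) + y * Q ^ t * σ (suc n′) s′)
                   (ℕ.+-suc h j) (shift h j) ⟩
      x * Q ^ t * Φ h (suc j) + y * Q ^ t * Φ (suc h) j
        ≈⟨ +-cong (*-congˡ (Φ-closed h (suc j))) (*-congˡ (Φ-closed (suc h) j)) ⟩
      x * Q ^ t * closed h (suc j) (qExponent h (suc j)) G₁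
        + y * Q ^ t * closed (suc h) j (qExponent (suc h) j) G₂
        ≈⟨ +-cong (closed-x t h (suc j) _ _) (closed-y t (suc h) j _ _) ⟩
      closed (suc h) (suc j) (t N.+ qExponent h (suc j)) G₁
        + closed (suc h) (suc j) (t N.+ qExponent (suc h) j) G₂
        ≡⟨ ≡.cong₂ (λ e₁ e₂ → closed (suc h) (suc j) e₁ G₁ + closed (suc h) (suc j) e₂ G₂)
                   (qExponent-sucˡ h (suc j)) exponent₂ ⟩
      closed (suc h) (suc j) E G₁ + closed (suc h) (suc j) (E N.+ suc h) G₂
        ≈⟨ closed-+ (suc h) (suc j) E (suc h) G₁ G₂ ⟩
      closed (suc h) (suc j) E (qBinomial Q (suc h) (suc j)) ∎
      where
      n = h N.+ suc j
      t = suc h N.+ (suc h N.+ suc j)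
      E = qExponent (suc h) (suc j)
      G₁ = qBinomial Q h (suc j)
      G₂ = qBinomial Q (suc h) j
      shift : ∀ h j → h N.+ suc (h N.+ suc j) ≡ suc (h N.+ suc (h N.+ j))
      shift = solve-∀
      exponent₂ : t N.+ qExponent (suc h) j ≡ E N.+ suc h
      exponent₂ = ≡.trans (regroup (suc h) j (qExponent (suc h) j)) (≡.cong (N._+ suc h) (qExponent-sucʳ (suc h) j))
        where
        regroup : ∀ m j e → m N.+ (m N.+ suc j) N.+ e ≡ suc (m N.+ j) N.+ e N.+ m
        regroup = solve-∀

    closed-poch : ∀ h′ j′ e h j → closed h′ j′ e (qBinomial Q h j) * poch R Q Q h * poch R Q Q j
                                   ≈ (x + y) * x ^ h′ * y ^ j′ * Q ^ e * poch R Q Q (h N.+ j)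
    closed-poch h′ j′ e h j = trans (trans (*-assoc _ _ _) (*-assoc _ _ _))
                                      (*-congˡ (trans (sym (*-assoc _ _ _)) (qBinomial-poch Q h j)))

    f-closed-A : ∀ h j → f (2 N.+ (h N.+ j)) A (2 N.+ (h N.+ (h N.+ j))) * poch R Q Q h * poch R Q Q j
                         ≈ (x + y) * x ^ suc h * y ^ j * Q ^ (2 N.+ (h N.+ (h N.+ j)) N.+ qExponent h j)
                           * poch R Q Q (h N.+ j)
    f-closed-A h j = trans (*-congʳ (*-congʳ (begin
      f (2 N.+ (h N.+ j)) A (2 N.+ s)                   ≈⟨ f-step (h N.+ j) A s ⟩
      x * Q ^ (2 N.+ s) * Φ h j                         ≈⟨ *-congˡ (Φ-closed h j) ⟩
      x * Q ^ (2 N.+ s) * closed h j (qExponent h j) (qBinomial Q h j)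
                                                        ≈⟨ closed-x (2 N.+ s) h j _ _ ⟩
      closed (suc h) j (2 N.+ s N.+ qExponent h j) (qBinomial Q h j) ∎)))
      (closed-poch (suc h) j (2 N.+ s N.+ qExponent h j) h j)
      where s = h N.+ (h N.+ j)

    f-closed-B : ∀ h j → f (2 N.+ (h N.+ j)) B (1 N.+ (h N.+ (h N.+ j))) * poch R Q Q h * poch R Q Q j
                         ≈ (x + y) * x ^ h * y ^ suc j * Q ^ (1 N.+ (h N.+ (h N.+ j)) N.+ qExponent h j)
                           * poch R Q Q (h N.+ j)
    f-closed-B h j = trans (*-congʳ (*-congʳ (begin
      f (2 N.+ (h N.+ j)) B (1 N.+ s)                   ≈⟨ f-step (h N.+ j) B s ⟩
      y * Q ^ (1 N.+ s) * Φ h j                         ≈⟨ *-congˡ (Φ-closed h j) ⟩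
      y * Q ^ (1 N.+ s) * closed h j (qExponent h j) (qBinomial Q h j)
                                                        ≈⟨ closed-y (1 N.+ s) h j _ _ ⟩
      closed h (suc j) (1 N.+ s N.+ qExponent h j) (qBinomial Q h j) ∎)))
      (closed-poch h (suc j) (1 N.+ s N.+ qExponent h j) h j)
      where s = h N.+ (h N.+ j)

module Parts (a b k : ℕ) {{_ : NonZero k}} (1≤a : 1 ≤ a) (a<b : a < b) (b≤k : b ≤ k) where
  open import Data.Nat using (_+_; _*_)

  residue : Kind → ℕ
  residue A = a
  residue B = b

  -- t * k rather than k * t, so that part κ 0 reduces to residue κ.
  part : Kind → ℕ → ℕ
  part κ t = t * k + residue κ

  infix 4 _≡[k]_
  _≡[k]_ : ℕ → ℕ → Set
  x ≡[k] y = _≡ₖ_ a b k x y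

  Admissible : ℕ → Set
  Admissible y = 1 ≤ y × (y ≡[k] a ⊎ y ≡[k] b)

  admissible? : ∀ y → Dec (Admissible y)
  admissible? y = (1 ℕ.≤? y) ×-dec (≡ₖ? a b k y a ⊎-dec ≡ₖ? a b k y b)

  data IsPart : ℕ → Set where
    is-part : ∀ κ t → IsPart (part κ t)

  1≤residue : ∀ κ → 1 ≤ residue κ
  1≤residue A = 1≤a
  1≤residue B = ℕ.<⇒≤ (ℕ.≤-<-trans 1≤a a<b)

  a≤residue : ∀ κ → a ≤ residue κ
  a≤residue A = ℕ.≤-refl
  a≤residue B = ℕ.<⇒≤ a<b

  residue≤b : ∀ κ → residue κ ≤ b
  residue≤b A = ℕ.<⇒≤ a<b
  residue≤b B = ℕ.≤-refl

  residue≤k : ∀ κ → residue κ ≤ k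
  residue≤k κ = ℕ.≤-trans (residue≤b κ) b≤k

  part-mod : ∀ κ t → part κ t % k ≡ residue κ % k
  part-mod κ t = ≡.trans (≡.cong (_% k) (ℕ.+-comm (t * k) (residue κ))) ([m+kn]%n≡m%n (residue κ) t k)

  a≢b-mod : a % k ≢ b % k
  a≢b-mod a≡b with ℕ.m≤n⇒m<n∨m≡n b≤k
  ... | inj₁ b<k    = ℕ.<-irrefl (≡.trans (≡.sym (m<n⇒m%n≡m (ℕ.<-trans a<b b<k)))
                                          (≡.trans a≡b (m<n⇒m%n≡m b<k))) a<b
  ... | inj₂ ≡.refl = ℕ.<-irrefl (≡.trans (≡.sym (n%n≡0 k)) (≡.trans (≡.sym a≡b) (m<n⇒m%n≡m a<b))) 1≤a

  part-admissible : ∀ κ t → Admissible (part κ t)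
  part-admissible κ t = ℕ.≤-trans (1≤residue κ) (ℕ.m≤n+m (residue κ) (t * k)) , residue-class κ
    where
    residue-class : ∀ κ → part κ t ≡[k] a ⊎ part κ t ≡[k] b
    residue-class A = inj₁ (part-mod A t)
    residue-class B = inj₂ (part-mod B t)

  residue-view : ∀ {y} r → r ≤ k → 1 ≤ y → y % k ≡ r % k → Σ ℕ λ t → y ≡ t * k + r
  residue-view {y} r r≤k 1≤y y≡r with ℕ.m≤n⇒m<n∨m≡n r≤k
  ... | inj₁ r<k = y / k , (begin
    y                 ≡⟨ m≡m%n+[m/n]*n y k ⟩
    y % k + y / k * k ≡⟨ ≡.cong (_+ y / k * k) (≡.trans y≡r (m<n⇒m%n≡m r<k)) ⟩
    r + y / k * k     ≡⟨ ℕ.+-comm r (y / k * k) ⟩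
    y / k * k + r     ∎)
    where open ≡.≡-Reasoning
  ... | inj₂ ≡.refl = multiple (y / k) (≡.trans (m≡m%n+[m/n]*n y k) (≡.cong (_+ y / k * k) (≡.trans y≡r (n%n≡0 k))))
    where
    multiple : ∀ d → y ≡ d * k → Σ ℕ λ t → y ≡ t * k + k
    multiple zero    y≡0 = contradiction (≡.subst (1 ≤_) y≡0 1≤y) λ ()
    multiple (suc t) y≡d = t , ≡.trans y≡d (ℕ.+-comm k (t * k))

  kind-of-residue : ∀ {y} → y ≡[k] a ⊎ y ≡[k] b → Σ Kind λ κ → y % k ≡ residue κ % k
  kind-of-residue (inj₁ y≡a) = A , y≡a
  kind-of-residue (inj₂ y≡b) = B , y≡b

  admissible⇒part : ∀ {y} → Admissible y → IsPart y
  admissible⇒part (1≤y , y≡r) with kind-of-residue y≡r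
  ... | κ , y≡κ with residue-view (residue κ) (residue≤k κ) 1≤y y≡κ
  ...   | t , ≡.refl = is-part κ t

  r<k+r′ : ∀ {r r′} → r ≤ k → 1 ≤ r′ → r < k + r′
  r<k+r′ {r} {r′} r≤k 1≤r′ = ℕ.≤-trans (ℕ.+-mono-≤ 1≤r′ r≤k) (ℕ.≤-reflexive (ℕ.+-comm r′ k))

  next-level : ∀ s r → s * k + (k + r) ≡ suc s * k + r
  next-level s r = ≡.trans (≡.sym (ℕ.+-assoc (s * k) k r)) (≡.cong (_+ r) (ℕ.+-comm (s * k) k))

  level-mono-≤ : ∀ {t s r r′} → t < s → r ≤ k + r′ → t * k + r ≤ s * k + r′
  level-mono-≤ {t} {s} {r} {r′} t<s r≤k+r′ = begin
    t * k + r         ≤⟨ ℕ.+-monoʳ-≤ (t * k) r≤k+r′ ⟩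
    t * k + (k + r′)  ≡⟨ next-level t r′ ⟩
    suc t * k + r′    ≤⟨ ℕ.+-monoˡ-≤ r′ (ℕ.*-monoˡ-≤ k t<s) ⟩
    s * k + r′        ∎
    where open ℕ.≤-Reasoning

  level-cancel-≤ : ∀ {t s r r′} → r′ < k + r → t * k + r ≤ s * k + r′ → t ≤ s
  level-cancel-≤ {t} {s} {r} {r′} r′<k+r t≤s = ℕ.≮⇒≥ λ s<t → ℕ.<⇒≱ (begin-strict
    s * k + r′       <⟨ ℕ.+-monoʳ-< (s * k) r′<k+r ⟩
    s * k + (k + r)  ≤⟨ level-mono-≤ s<t ℕ.≤-refl ⟩
    t * k + r        ∎) t≤s
    where open ℕ.≤-Reasoning

  level-cancel-< : ∀ {t s r r′} → r′ < r → t * k + r ≤ s * k + r′ → t < s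
  level-cancel-< {t} {s} {r} {r′} r′<r t≤s = ℕ.≰⇒> λ s≤t → ℕ.<⇒≱ (begin-strict
    s * k + r′  <⟨ ℕ.+-monoʳ-< (s * k) r′<r ⟩
    s * k + r   ≤⟨ ℕ.+-monoˡ-≤ r (ℕ.*-monoˡ-≤ k s≤t) ⟩
    t * k + r   ∎) t≤s
    where open ℕ.≤-Reasoning

  level-mono-< : ∀ {t s r r′} → t < s → r < k + r′ → t * k + r < s * k + r′
  level-mono-< {t} {r = r} t<s r<k+r′ = ℕ.≤-trans (ℕ.≤-reflexive (≡.sym (ℕ.+-suc (t * k) r))) (level-mono-≤ t<s r<k+r′)

  private
    k+level : ∀ s r → k + (s * k + r) ≡ suc s * k + r
    k+level s r = ≡.sym (ℕ.+-assoc k (s * k) r)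

    2k+level : ∀ s r → 2 * k + (s * k + r) ≡ suc (suc s) * k + r
    2k+level s r = eq k s r
      where eq : ∀ k s r → 2 * k + (s * k + r) ≡ suc (suc s) * k + r
            eq = solve-∀

    gap-intro : ∀ {t s r r′} → let x = t * k + r; y = s * k + r′ in
                suc s * k + r′ ≤ x → (x ≡[k] a → suc s * k + r′ < x) →
                x ≤ suc (suc s) * k + r′ → (y ≡[k] b → x < suc (suc s) * k + r′) →
                Gap a b k x y
    gap-intro {t} {s} {r} {r′} lower lower-strict upper upper-strict =
      ≡.subst (_≤ x) (≡.sym (k+level s r′)) lower ,
      (λ x≡a → ≡.subst (_< x) (≡.sym (k+level s r′)) (lower-strict x≡a)) ,
      ≡.subst (x ≤_) (≡.sym (2k+level s r′)) upper ,
      (λ y≡b → ≡.subst (x <_) (≡.sym (2k+level s r′)) (upper-strict y≡b))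
      where x = t * k + r

  part-A≢ₖb : ∀ t → ¬ part A t ≡[k] b
  part-A≢ₖb t eq = a≢b-mod (≡.trans (≡.sym (part-mod A t)) eq)

  part-B≢ₖa : ∀ t → ¬ part B t ≡[k] a
  part-B≢ₖa t eq = a≢b-mod (≡.sym (≡.trans (≡.sym (part-mod B t)) eq))

  descent-gap : ∀ κ κ′ s → Gap a b k (part κ (descent κ + s)) (part κ′ s)
  descent-gap A κ′ s =
    gap-intro {suc (suc s)} {s} (ℕ.<⇒≤ lower) (λ _ → lower) (ℕ.+-monoʳ-≤ _ (a≤residue κ′)) (upper-strict κ′)
    where
    lower : suc s * k + residue κ′ < suc (suc s) * k + a
    lower = level-mono-< (ℕ.n<1+n (suc s)) (r<k+r′ (residue≤k κ′) 1≤a)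
    upper-strict : ∀ κ′ → part κ′ s ≡[k] b → suc (suc s) * k + a < suc (suc s) * k + residue κ′
    upper-strict A y≡b = contradiction y≡b (part-A≢ₖb s)
    upper-strict B _   = ℕ.+-monoʳ-< _ a<b
  descent-gap B κ′ s =
    gap-intro {suc s} {s} (ℕ.+-monoʳ-≤ _ (residue≤b κ′)) (λ x≡a → contradiction x≡a (part-B≢ₖa (suc s)))
              (level-mono-≤ (ℕ.n<1+n (suc s)) (ℕ.<⇒≤ (r<k+r′ b≤k (1≤residue κ′)))) (upper-strict κ′)
    where
    upper-strict : ∀ κ′ → part κ′ s ≡[k] b → suc s * k + b < suc (suc s) * k + residue κ′
    upper-strict A y≡b = contradiction y≡b (part-A≢ₖb s)
    upper-strict B _   = level-mono-< (ℕ.n<1+n (suc s)) (r<k+r′ b≤k (1≤residue B))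

  gap⇒descent : ∀ κ κ′ t s → Gap a b k (part κ t) (part κ′ s) → t ≡ descent κ + s
  gap⇒descent A κ′ t s (_ , lower-strict , upper , _) = ℕ.≤-antisym t≤2+s 2+s≤t
    where
    r′ = residue κ′
    2+s≤t : suc (suc s) ≤ t
    2+s≤t = level-cancel-< (s≤s (a≤residue κ′)) (≡.subst (_≤ part A t) next (lower-strict (part-mod A t)))
      where next = ≡.trans (≡.cong suc (k+level s r′)) (≡.sym (ℕ.+-suc (suc s * k) r′))
    t≤2+s : t ≤ suc (suc s)
    t≤2+s = level-cancel-≤ (r<k+r′ (residue≤k κ′) 1≤a) (≡.subst (part A t ≤_) (2k+level s r′) upper)
  gap⇒descent B κ′ t s (lower , _ , upper , upper-strict) = ℕ.≤-antisym (t≤1+s κ′ upper upper-strict) 1+s≤t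
    where
    1+s≤t : suc s ≤ t
    1+s≤t = level-cancel-≤ (r<k+r′ b≤k (1≤residue κ′)) (≡.subst (_≤ part B t) (k+level s (residue κ′)) lower)
    t≤1+s : ∀ κ′ → part B t ≤ 2 * k + part κ′ s → (part κ′ s ≡[k] b → part B t < 2 * k + part κ′ s) →
            t ≤ suc s
    t≤1+s A upper _ = s≤s⁻¹ (level-cancel-< a<b (≡.subst (part B t ≤_) (2k+level s a) upper))
    t≤1+s B _ upper-strict = s≤s⁻¹ (level-cancel-< (ℕ.n<1+n b)
      (≡.subst₂ _≤_ (≡.sym (ℕ.+-suc (t * k) b)) (2k+level s b) (upper-strict (part-mod B s))))

  gap⇒≤ : ∀ {x y} → Gap a b k x y → y ≤ x
  gap⇒≤ (k+y≤x , _) = ℕ.≤-trans (ℕ.m≤n+m _ k) k+y≤x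

  b<part-suc : ∀ κ t → b < part κ (suc t)
  b<part-suc κ t = ℕ.≤-trans (r<k+r′ b≤k (1≤residue κ)) (ℕ.+-monoˡ-≤ (residue κ) (ℕ.m≤m+n k (t * k)))

  part-A≢part-B : ∀ s → part A s ≢ part B s
  part-A≢part-B s eq = ℕ.<-irrefl (ℕ.+-cancelˡ-≡ (s * k) a b eq) a<b

module _ where
  open import Data.Nat using (_+_; _*_)

  [2+h+j]∸h∸2≡j : ∀ h j → suc (suc (h + j)) ∸ h ∸ 2 ≡ j
  [2+h+j]∸h∸2≡j zero    j = ≡.refl
  [2+h+j]∸h∸2≡j (suc h) j = [2+h+j]∸h∸2≡j h j

  [2+h+j]∸h∸1≡1+j : ∀ h j → suc (suc (h + j)) ∸ h ∸ 1 ≡ suc j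
  [2+h+j]∸h∸1≡1+j zero    j = ≡.refl
  [2+h+j]∸h∸1≡1+j (suc h) j = [2+h+j]∸h∸1≡1+j h j

  largest-part-A : ∀ k a h j → k * (h + 1) + k * suc (h + j) + a ≡ suc (suc (h + (h + j))) * k + a
  largest-part-A = solve-∀

  largest-part-B : ∀ k b h j → k * h + k * suc (h + j) + b ≡ suc (h + (h + j)) * k + b
  largest-part-B = solve-∀

  -- As b ≤ k, the truncated k ∸ b is a genuine K with k = K + b, which makes both sides polynomial.
  q-exponent-A : ∀ k b a h j → b ≤ k →
                 a * suc h + b * j + k * (2 + (h + (h + j)) + qExponent h j)
                 ≡ k * (suc (suc (h + j)) C 2) + k * ((h + 1) C 2) + suc (h + j) * b + (k ∸ b + a) * (h + 1)
  q-exponent-A k b a h j b≤k with k ∸ b | ℕ.m∸n+n≡m b≤k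
  ... | K | ≡.refl = ≡.trans (shape K b a h j _ _)
    (≡.cong₂ (λ Cm i → (K + b) * Cm + (K + b) * (i C 2) + suc (h + j) * b + (K + a) * i)
             (≡.sym (C₂-suc (suc (h + j)))) (ℕ.+-comm 1 h))
    where
    shape : ∀ K b a h j X Y → a * suc h + b * j + (K + b) * (2 + (h + (h + j)) + (X + Y))
                              ≡ (K + b) * (suc (h + j) + X) + (K + b) * Y + suc (h + j) * b + (K + a) * suc h
    shape = solve-∀

  q-exponent-B : ∀ k b a h j → b ≤ k →
                 a * h + b * suc j + k * (1 + (h + (h + j)) + qExponent h j)
                 ≡ k * (suc (suc (h + j)) C 2) + k * ((h + 1) C 2) + suc (h + j) * b + (k ∸ b + a) * h
  q-exponent-B k b a h j b≤k with k ∸ b | ℕ.m∸n+n≡m b≤k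
  ... | K | ≡.refl = ≡.trans (shape K b a h j _ _)
    (≡.cong₂ (λ Cm i → (K + b) * Cm + (K + b) * (i C 2) + suc (h + j) * b + (K + a) * h)
             (≡.sym (C₂-suc (suc (h + j)))) (ℕ.+-comm 1 h))
    where
    shape : ∀ K b a h j X Y → a * h + b * suc j + (K + b) * (1 + (h + (h + j)) + (X + Y))
                              ≡ (K + b) * (suc (h + j) + X) + (K + b) * Y + suc (h + j) * b + (K + a) * h
    shape = solve-∀

module GeneratingFunction {c ℓ} (R : CommutativeRing c ℓ) (a b k : ℕ) {{_ : NonZero k}}
    (1≤a : 1 ≤ a) (a<b : a < b) (b≤k : b ≤ k) (u v q : CommutativeRing.Carrier R) where
  open CommutativeRing R
  open RS (Algebra.Bundles.Semiring.rawSemiring semiring) using (_^_)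
  open import Algebra.Properties.CommutativeSemiring.Exp commutativeSemiring using (^-homo-*; ^-assocʳ; ^-distrib-*)
  open import Algebra.Properties.Semiring.Sum semiring using (sum-syntax; sum-cong-≋; *-distribˡ-sum)
  open import Algebra.Solver.Ring.NaturalCoefficients.Default commutativeSemiring
  open import Relation.Binary.Reasoning.Setoid setoid
  open Parts a b k 1≤a a<b b≤k
  open RingSums R

  weight : List ℕ → Carrier
  weight λs = u ^ ℓa a b k λs * v ^ ℓb a b k λs * q ^ size a b k λs

  gen : ℕ → ℕ → Carrier
  gen m N = genBD R a b k m N u v q

  summand : ℕ → ℕ → List ℕ → Carrier
  summand m N λs = indicator (BD′max? a b k m N λs) (weight λs)

  marker : Kind → Carrier
  marker A = u
  marker B = v

  w : Kind → Carrier
  w κ = marker κ * q ^ residue κ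

  weight-∷ : ∀ κ t λs → weight (part κ t ∷ λs) ≈ marker κ * q ^ part κ t * weight λs
  weight-∷ κ t λs = begin
    u ^ ℓa a b k (x ∷ λs) * v ^ ℓb a b k (x ∷ λs) * q ^ (x N.+ size a b k λs)
      ≡⟨ ≡.cong₂ (λ i j → u ^ i * v ^ j * q ^ (x N.+ size a b k λs)) (ℓa-∷ κ) (ℓb-∷ κ) ⟩
    u ^ (countA κ N.+ ℓa a b k λs) * v ^ (countB κ N.+ ℓb a b k λs) * q ^ (x N.+ size a b k λs)
      ≈⟨ *-cong (*-cong (^-homo-* u (countA κ) _) (^-homo-* v (countB κ) _)) (^-homo-* q x _) ⟩
    (u ^ countA κ * u ^ ℓa a b k λs) * (v ^ countB κ * v ^ ℓb a b k λs) * (q ^ x * q ^ size a b k λs)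
      ≈⟨ solve 6 (λ U V Qx uⁱ vʲ Qˢ → (U :* uⁱ) :* (V :* vʲ) :* (Qx :* Qˢ) := U :* V :* Qx :* (uⁱ :* vʲ :* Qˢ)) refl
                 (u ^ countA κ) (v ^ countB κ) (q ^ x) (u ^ ℓa a b k λs) (v ^ ℓb a b k λs) (q ^ size a b k λs) ⟩
    u ^ countA κ * v ^ countB κ * q ^ x * weight λs
      ≈⟨ *-congʳ (*-congʳ (marker-count κ)) ⟩
    marker κ * q ^ x * weight λs ∎
    where
    x = part κ t
    countA countB : Kind → ℕ
    countA A = 1
    countA B = 0
    countB A = 0
    countB B = 1
    ℓa-∷ : ∀ κ → ℓa a b k (part κ t ∷ λs) ≡ countA κ N.+ ℓa a b k λs
    ℓa-∷ A = ≡.cong length (List.filter-accept (λ x → ≡ₖ? a b k x a) (part-mod A t))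
    ℓa-∷ B = ≡.cong length (List.filter-reject (λ x → ≡ₖ? a b k x a) (part-B≢ₖa t))
    ℓb-∷ : ∀ κ → ℓb a b k (part κ t ∷ λs) ≡ countB κ N.+ ℓb a b k λs
    ℓb-∷ A = ≡.cong length (List.filter-reject (λ x → ≡ₖ? a b k x b) (part-A≢ₖb t))
    ℓb-∷ B = ≡.cong length (List.filter-accept (λ x → ≡ₖ? a b k x b) (part-mod B t))
    marker-count : ∀ κ → u ^ countA κ * v ^ countB κ ≈ marker κ
    marker-count A = trans (*-identityʳ _) (*-identityʳ u)
    marker-count B = trans (*-identityˡ _) (*-identityʳ v)

  summand-head : ∀ m N x λs → x ≢ N → summand m N (x ∷ λs) ≈ 0#
  summand-head m N x λs x≢N =
    indicator-no (BD′max? a b k m N (x ∷ λs)) (λ (_ , head≡N) → x≢N (Maybe.just-injective head≡N)) _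

  summand-bounded : ∀ m N λs → ¬ All (_≤ N) λs → summand m N (N ∷ λs) ≈ 0#
  summand-bounded m N λs ¬λs≤N = indicator-no (BD′max? a b k m N (N ∷ λs)) bounded _
    where
    bounded : ¬ BD′max a b k m N (N ∷ λs)
    bounded ((_ , _ , decreasing , _) , _) with Linked⇒All (λ j≤i k≤j → ℕ.≤-trans k≤j j≤i) ℕ.≤-refl decreasing
    ... | _ ∷ λs≤N = ¬λs≤N λs≤N

  gen-head : ∀ m N M → N ≤ M → gen (suc m) N ≈ ∑ R (map (λ λs → summand (suc m) N (N ∷ λs)) (lists M m))
  gen-head m N M N≤M = begin
    gen (suc m) N
      ≈⟨ ∑-filter (BD′max? a b k (suc m) N) weight (lists N (suc m)) ⟩
    ∑ R (map (summand (suc m) N) (lists N (suc m)))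
      ≈⟨ ∑-lists-suc N m (summand (suc m) N) ⟩
    ∑[ x < suc N ] ∑ R (map (λ λs → summand (suc m) N (toℕ x ∷ λs)) (lists N m))
      ≈⟨ ∑-point (suc N) (λ x → ∑ R (map (λ λs → summand (suc m) N (x ∷ λs)) (lists N m))) (ℕ.n<1+n N)
                 (λ x x≢N → ∑-map-zero (λ λs → summand-head (suc m) N x λs x≢N) (lists N m)) ⟩
    ∑ R (map (λ λs → summand (suc m) N (N ∷ λs)) (lists N m))
      ≈⟨ ∑-lists-truncate N (M ∸ N) m _ (summand-bounded (suc m) N) ⟨
    ∑ R (map (λ λs → summand (suc m) N (N ∷ λs)) (lists (N N.+ (M ∸ N)) m))
      ≡⟨ ≡.cong (λ M → ∑ R (map (λ λs → summand (suc m) N (N ∷ λs)) (lists M m))) (ℕ.m+[n∸m]≡n N≤M) ⟩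
    ∑ R (map (λ λs → summand (suc m) N (N ∷ λs)) (lists M m)) ∎

  gen-inadmissible : ∀ m N → ¬ Admissible N → gen (suc m) N ≈ 0#
  gen-inadmissible m N ¬adm = trans (gen-head m N N ℕ.≤-refl) (∑-map-zero vanish (lists N m))
    where
    vanish : ∀ λs → summand (suc m) N (N ∷ λs) ≈ 0#
    vanish λs = indicator-no (BD′max? a b k (suc m) N (N ∷ λs))
                  (λ { ((_ , (1≤N ∷ _) , _ , (N≡r ∷ _) , _) , _) → ¬adm (1≤N , N≡r) }) _

  BD′-∷∷ : ∀ m N y ys → Admissible N →
           BD′max a b k (suc (suc m)) N (N ∷ y ∷ ys) ⇔ (Gap a b k N y × BD′max a b k (suc m) y (y ∷ ys))
  BD′-∷∷ m N y ys (1≤N , N≡r) = mk⇔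
    (λ { ((len , (_ ∷ pos) , (_ ∷ dec) , (_ ∷ cls) , lst , (gap ∷ gaps)) , _) →
           gap , ((ℕ.suc-injective len , pos , dec , cls , lst , gaps) , ≡.refl) })
    (λ { (gap , ((len , pos , dec , cls , lst , gaps) , _)) →
           (≡.cong suc len , (1≤N ∷ pos) , (gap⇒≤ gap ∷ dec) , (N≡r ∷ cls) , lst , (gap ∷ gaps)) , ≡.refl })

  summand-∷∷ : ∀ m κ t y ys → let N = part κ t in
               summand (suc (suc m)) N (N ∷ y ∷ ys)
               ≈ marker κ * q ^ N * indicator (gap? a b k N y) (summand (suc m) y (y ∷ ys))
  summand-∷∷ m κ t y ys = begin
    indicator (BD′max? a b k (suc (suc m)) N (N ∷ y ∷ ys)) (weight (N ∷ y ∷ ys))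
      ≈⟨ indicator-⇔ (BD′max? a b k (suc (suc m)) N (N ∷ y ∷ ys)) (gap? a b k N y ×-dec tail?)
                     (BD′-∷∷ m N y ys (part-admissible κ t)) _ ⟩
    indicator (gap? a b k N y ×-dec tail?) (weight (N ∷ y ∷ ys))
      ≈⟨ indicator-× (gap? a b k N y) tail? _ ⟩
    indicator (gap? a b k N y) (indicator tail? (weight (N ∷ y ∷ ys)))
      ≈⟨ indicator-cong (gap? a b k N y) (indicator-cong tail? (weight-∷ κ t (y ∷ ys))) ⟩
    indicator (gap? a b k N y) (indicator tail? (leading * weight (y ∷ ys)))
      ≈⟨ indicator-cong (gap? a b k N y) (indicator-*ˡ tail? leading _) ⟩
    indicator (gap? a b k N y) (leading * indicator tail? (weight (y ∷ ys)))
      ≈⟨ indicator-*ˡ (gap? a b k N y) leading _ ⟩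
    leading * indicator (gap? a b k N y) (summand (suc m) y (y ∷ ys)) ∎
    where
    N = part κ t
    leading = marker κ * q ^ N
    tail? = BD′max? a b k (suc m) y (y ∷ ys)

  gen-rec : ∀ m κ t → let N = part κ t in
            gen (suc (suc m)) N
            ≈ marker κ * q ^ N * ∑[ y < suc N ] indicator (gap? a b k N (toℕ y)) (gen (suc m) (toℕ y))
  gen-rec m κ t = begin
    gen (suc (suc m)) N
      ≈⟨ gen-head (suc m) N N ℕ.≤-refl ⟩
    ∑ R (map (λ λs → summand (suc (suc m)) N (N ∷ λs)) (lists N (suc m)))
      ≈⟨ ∑-lists-suc N m _ ⟩
    ∑[ y < suc N ] ∑ R (map (λ ys → summand (suc (suc m)) N (N ∷ toℕ y ∷ ys)) (lists N m))
      ≈⟨ sum-cong-≋ {suc N} (λ y → second-part (toℕ y) (s≤s⁻¹ (Fin.toℕ<n y))) ⟩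
    ∑[ y < suc N ] (leading * indicator (gap? a b k N (toℕ y)) (gen (suc m) (toℕ y)))
      ≈⟨ *-distribˡ-sum {suc N} leading (λ y → indicator (gap? a b k N (toℕ y)) (gen (suc m) (toℕ y))) ⟨
    leading * ∑[ y < suc N ] indicator (gap? a b k N (toℕ y)) (gen (suc m) (toℕ y)) ∎
    where
    N = part κ t
    leading = marker κ * q ^ N
    second-part : ∀ y → y ≤ N → ∑ R (map (λ ys → summand (suc (suc m)) N (N ∷ y ∷ ys)) (lists N m))
                                ≈ leading * indicator (gap? a b k N y) (gen (suc m) y)
    second-part y y≤N = begin
      ∑ R (map (λ ys → summand (suc (suc m)) N (N ∷ y ∷ ys)) (lists N m))
        ≈⟨ ∑-map-cong (summand-∷∷ m κ t y) (lists N m) ⟩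
      ∑ R (map (λ ys → leading * indicator (gap? a b k N y) (summand (suc m) y (y ∷ ys))) (lists N m))
        ≈⟨ ∑-map-*ˡ leading _ (lists N m) ⟨
      leading * ∑ R (map (indicator (gap? a b k N y) ∘ (λ ys → summand (suc m) y (y ∷ ys))) (lists N m))
        ≈⟨ *-congˡ (∑-map-indicator (gap? a b k N y) _ (lists N m)) ⟨
      leading * indicator (gap? a b k N y) (∑ R (map (λ ys → summand (suc m) y (y ∷ ys)) (lists N m)))
        ≈⟨ *-congˡ (indicator-cong (gap? a b k N y) (gen-head m y N y≤N)) ⟨
      leading * indicator (gap? a b k N y) (gen (suc m) y) ∎

  gap-term-vanishes : ∀ m κ t y → (∀ κ′ s′ → t ≡ descent κ N.+ s′ → y ≢ part κ′ s′) →
                      indicator (gap? a b k (part κ t) y) (gen (suc m) y) ≈ 0#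
  gap-term-vanishes m κ t y excluded with gap? a b k (part κ t) y
  ... | no _ = refl
  ... | yes gap with admissible? y
  ...   | no ¬adm = gen-inadmissible m y ¬adm
  ...   | yes adm with admissible⇒part adm
  ...     | is-part κ′ s′ = contradiction ≡.refl (excluded κ′ s′ (gap⇒descent κ κ′ t s′ gap))

  gen-step : ∀ m κ s → let N = part κ (descent κ N.+ s) in
             gen (suc (suc m)) N ≈ marker κ * q ^ N * (gen (suc m) (part A s) + gen (suc m) (part B s))
  gen-step m κ s = trans (gen-rec m κ t) (*-congˡ (begin
    ∑[ y < suc N ] term (toℕ y)
      ≈⟨ ∑-two-points (suc N) term (part-A≢part-B s)
                      (s≤s (gap⇒≤ (descent-gap κ A s))) (s≤s (gap⇒≤ (descent-gap κ B s)))
                      (λ y y≢A y≢B → gap-term-vanishes m κ t y (excluded y≢A y≢B)) ⟩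
    term (part A s) + term (part B s)
      ≈⟨ +-cong (indicator-yes (gap? a b k N (part A s)) (descent-gap κ A s) _)
                (indicator-yes (gap? a b k N (part B s)) (descent-gap κ B s) _) ⟩
    gen (suc m) (part A s) + gen (suc m) (part B s) ∎))
    where
    t = descent κ N.+ s
    N = part κ t
    term : ℕ → Carrier
    term y = indicator (gap? a b k N y) (gen (suc m) y)
    excluded : ∀ {y} → y ≢ part A s → y ≢ part B s → ∀ κ′ s′ → t ≡ descent κ N.+ s′ → y ≢ part κ′ s′
    excluded y≢A y≢B κ′ s′ t≡ with ℕ.+-cancelˡ-≡ (descent κ) s s′ t≡
    excluded y≢A y≢B A s′ t≡ | ≡.refl = y≢A
    excluded y≢A y≢B B s′ t≡ | ≡.refl = y≢B

  gen-low : ∀ m κ t → t < descent κ → gen (suc (suc m)) (part κ t) ≈ 0#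
  gen-low m κ t t<d = trans (gen-rec m κ t) (trans (*-congˡ (sum-zero {suc (part κ t)} _ vanish)) (zeroʳ _))
    where
    vanish : ∀ y → indicator (gap? a b k (part κ t) (toℕ y)) (gen (suc m) (toℕ y)) ≈ 0#
    vanish y = gap-term-vanishes m κ t (toℕ y)
      (λ κ′ s′ t≡ _ → ℕ.<⇒≱ t<d (ℕ.≤-trans (ℕ.m≤m+n (descent κ) s′) (ℕ.≤-reflexive (≡.sym t≡))))

  gen-one-zero : ∀ κ → gen 1 (part κ 0) ≈ w κ
  gen-one-zero κ = begin
    gen 1 r                            ≈⟨ gen-head 0 r r ℕ.≤-refl ⟩
    summand 1 r (r ∷ []) + 0#          ≈⟨ +-identityʳ _ ⟩
    summand 1 r (r ∷ [])               ≈⟨ indicator-yes (BD′max? a b k 1 r (r ∷ [])) single _ ⟩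
    weight (r ∷ [])                    ≈⟨ weight-∷ κ 0 [] ⟩
    marker κ * q ^ r * (1# * 1# * 1#)  ≈⟨ *-congˡ (trans (*-identityʳ _) (*-identityʳ 1#)) ⟩
    marker κ * q ^ r * 1#              ≈⟨ *-identityʳ _ ⟩
    w κ                                ∎
    where
    r = residue κ
    last-residue : ∀ κ → last (residue κ ∷ []) ≡ just a ⊎ last (residue κ ∷ []) ≡ just b
    last-residue A = inj₁ ≡.refl
    last-residue B = inj₂ ≡.refl
    single : BD′max a b k 1 r (r ∷ [])
    single = (≡.refl , (proj₁ (part-admissible κ 0) ∷ []) , [-] , (proj₂ (part-admissible κ 0) ∷ [])
             , last-residue κ , [-]) , ≡.refl

  gen-one-suc : ∀ κ t → gen 1 (part κ (suc t)) ≈ 0#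
  gen-one-suc κ t = begin
    gen 1 N                    ≈⟨ gen-head 0 N N ℕ.≤-refl ⟩
    summand 1 N (N ∷ []) + 0#  ≈⟨ +-identityʳ _ ⟩
    summand 1 N (N ∷ [])       ≈⟨ indicator-no (BD′max? a b k 1 N (N ∷ [])) not-last _ ⟩
    0#                         ∎
    where
    N = part κ (suc t)
    not-last : ¬ BD′max a b k 1 N (N ∷ [])
    not-last ((_ , _ , _ , _ , inj₁ N≡a , _) , _) = ℕ.<⇒≢ (ℕ.<-trans a<b (b<part-suc κ t)) (≡.sym (Maybe.just-injective N≡a))
    not-last ((_ , _ , _ , _ , inj₂ N≡b , _) , _) = ℕ.<⇒≢ (b<part-suc κ t) (≡.sym (Maybe.just-injective N≡b))

  weight-of-part : ∀ κ t → marker κ * q ^ part κ t ≈ w κ * (q ^ k) ^ t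
  weight-of-part κ t = begin
    marker κ * q ^ (t N.* k N.+ r)      ≈⟨ *-congˡ (^-homo-* q (t N.* k) r) ⟩
    marker κ * (q ^ (t N.* k) * q ^ r)  ≡⟨ ≡.cong (λ e → marker κ * (q ^ e * q ^ r)) (ℕ.*-comm t k) ⟩
    marker κ * (q ^ (k N.* t) * q ^ r)  ≈⟨ *-congˡ (*-congʳ (^-assocʳ q k t)) ⟨
    marker κ * ((q ^ k) ^ t * q ^ r)    ≈⟨ solve 3 (λ m Qᵗ qʳ → m :* (Qᵗ :* qʳ) := m :* qʳ :* Qᵗ) refl
                                                    (marker κ) ((q ^ k) ^ t) (q ^ r) ⟩
    marker κ * q ^ r * (q ^ k) ^ t      ∎
    where r = residue κ

  open SolveRecurrence R using (Recurrence; module Solution)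

  recurrence : Recurrence (q ^ k) w (λ m κ t → gen m (part κ t))
  recurrence = record
    { f-one-zero = gen-one-zero
    ; f-one-suc  = gen-one-suc
    ; f-low      = gen-low
    ; f-step     = λ n κ s → trans (gen-step n κ s) (*-congʳ (weight-of-part κ (descent κ N.+ s)))
    }

  open Solution recurrence using (x; y; f-closed-A; f-closed-B)

  power-of-monomial : ∀ z e i → (z * q ^ e) ^ i ≈ z ^ i * q ^ (e N.* i)
  power-of-monomial z e i = trans (^-distrib-* z (q ^ e) i) (*-congˡ (^-assocʳ q e i))

  expand-monomial : ∀ P i j e → P * w A ^ i * w B ^ j * (q ^ k) ^ e
                         ≈ P * u ^ i * v ^ j * q ^ (a N.* i N.+ b N.* j N.+ k N.* e)
  expand-monomial P i j e = begin
    P * (u * q ^ a) ^ i * (v * q ^ b) ^ j * (q ^ k) ^ e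
      ≈⟨ *-cong (*-cong (*-congˡ (power-of-monomial u a i)) (power-of-monomial v b j)) (^-assocʳ q k e) ⟩
    P * (u ^ i * q ^ (a N.* i)) * (v ^ j * q ^ (b N.* j)) * q ^ (k N.* e)
      ≈⟨ solve 6 (λ P uⁱ vʲ q₁ q₂ q₃ → P :* (uⁱ :* q₁) :* (vʲ :* q₂) :* q₃ := P :* uⁱ :* vʲ :* (q₁ :* q₂ :* q₃)) refl
                 P (u ^ i) (v ^ j) (q ^ (a N.* i)) (q ^ (b N.* j)) (q ^ (k N.* e)) ⟩
    P * u ^ i * v ^ j * (q ^ (a N.* i) * q ^ (b N.* j) * q ^ (k N.* e))
      ≈⟨ *-congˡ (trans (^-homo-* q (a N.* i N.+ b N.* j) (k N.* e)) (*-congʳ (^-homo-* q (a N.* i) (b N.* j)))) ⟨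
    P * u ^ i * v ^ j * q ^ (a N.* i N.+ b N.* j N.+ k N.* e) ∎

  BD′[m,h,a]-gf : ∀ h j → let m = suc (suc (h N.+ j)) in
    genBD R a b k m (k N.* (h N.+ 1) N.+ k N.* (m ∸ 1) N.+ a) u v q * qfac R q k h * qfac R q k (m ∸ 2 ∸ h)
    ≈ (u * q ^ a + v * q ^ b) * u ^ (h N.+ 1) * v ^ (m ∸ h ∸ 2)
      * q ^ (k N.* (m C 2) N.+ k N.* ((h N.+ 1) C 2) N.+ (m ∸ 1) N.* b N.+ (k ∸ b N.+ a) N.* (h N.+ 1))
      * qfac R q k (m ∸ 2)
  BD′[m,h,a]-gf h j = begin
    gen m (k N.* (h N.+ 1) N.+ k N.* suc (h N.+ j) N.+ a) * qf h * qf (h N.+ j ∸ h)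
      ≡⟨ ≡.cong₂ (λ N i → gen m N * qf h * qf i) (largest-part-A k a h j) (ℕ.m+n∸m≡n h j) ⟩
    gen m (part A (2 N.+ (h N.+ (h N.+ j)))) * qf h * qf j
      ≈⟨ f-closed-A h j ⟩
    (x + y) * x ^ suc h * y ^ j * (q ^ k) ^ e * qf (h N.+ j)
      ≈⟨ *-congʳ (expand-monomial (x + y) (suc h) j e) ⟩
    (x + y) * u ^ suc h * v ^ j * q ^ (a N.* suc h N.+ b N.* j N.+ k N.* e) * qf (h N.+ j)
      ≡⟨ ≡.cong₂ (λ i e → (x + y) * u ^ i * v ^ j * q ^ e * qf (h N.+ j))
                 (ℕ.+-comm 1 h) (q-exponent-A k b a h j b≤k) ⟩
    (x + y) * u ^ (h N.+ 1) * v ^ j * q ^ E * qf (h N.+ j)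
      ≡⟨ ≡.cong (λ j′ → (x + y) * u ^ (h N.+ 1) * v ^ j′ * q ^ E * qf (h N.+ j)) ([2+h+j]∸h∸2≡j h j) ⟨
    (x + y) * u ^ (h N.+ 1) * v ^ (m ∸ h ∸ 2) * q ^ E * qf (h N.+ j) ∎
    where
    m = suc (suc (h N.+ j))
    qf = qfac R q k
    e = 2 N.+ (h N.+ (h N.+ j)) N.+ qExponent h j
    E = k N.* (m C 2) N.+ k N.* ((h N.+ 1) C 2) N.+ (m ∸ 1) N.* b N.+ (k ∸ b N.+ a) N.* (h N.+ 1)

  BD′[m,h,b]-gf : ∀ h j → let m = suc (suc (h N.+ j)) in
    genBD R a b k m (k N.* h N.+ k N.* (m ∸ 1) N.+ b) u v q * qfac R q k h * qfac R q k (m ∸ 2 ∸ h)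
    ≈ (u * q ^ a + v * q ^ b) * u ^ h * v ^ (m ∸ h ∸ 1)
      * q ^ (k N.* (m C 2) N.+ k N.* ((h N.+ 1) C 2) N.+ (m ∸ 1) N.* b N.+ (k ∸ b N.+ a) N.* h)
      * qfac R q k (m ∸ 2)
  BD′[m,h,b]-gf h j = begin
    gen m (k N.* h N.+ k N.* suc (h N.+ j) N.+ b) * qf h * qf (h N.+ j ∸ h)
      ≡⟨ ≡.cong₂ (λ N i → gen m N * qf h * qf i) (largest-part-B k b h j) (ℕ.m+n∸m≡n h j) ⟩
    gen m (part B (1 N.+ (h N.+ (h N.+ j)))) * qf h * qf j
      ≈⟨ f-closed-B h j ⟩
    (x + y) * x ^ h * y ^ suc j * (q ^ k) ^ e * qf (h N.+ j)
      ≈⟨ *-congʳ (expand-monomial (x + y) h (suc j) e) ⟩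
    (x + y) * u ^ h * v ^ suc j * q ^ (a N.* h N.+ b N.* suc j N.+ k N.* e) * qf (h N.+ j)
      ≡⟨ ≡.cong₂ (λ j′ e → (x + y) * u ^ h * v ^ j′ * q ^ e * qf (h N.+ j))
                 (≡.sym ([2+h+j]∸h∸1≡1+j h j)) (q-exponent-B k b a h j b≤k) ⟩
    (x + y) * u ^ h * v ^ (m ∸ h ∸ 1) * q ^ E * qf (h N.+ j) ∎
    where
    m = suc (suc (h N.+ j))
    qf = qfac R q k
    e = 1 N.+ (h N.+ (h N.+ j)) N.+ qExponent h j
    E = k N.* (m C 2) N.+ k N.* ((h N.+ 1) C 2) N.+ (m ∸ 1) N.* b N.+ (k ∸ b N.+ a) N.* h

mainTheorem18 : ∀ {c ℓ} (R : CommutativeRing c ℓ) (a b k : ℕ) {{_ : NonZero k}}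
    → 1 ≤ a → a < b → b ≤ k
    → (m h : ℕ) → 2 ≤ m → h ≤ m ∸ 2
    → (u v q : CommutativeRing.Carrier R)
    → let open CommutativeRing R
          open RS (Algebra.Bundles.Semiring.rawSemiring semiring) using (_^_)
      in ((genBD R a b k m (k N.* (h N.+ 1) N.+ k N.* (m ∸ 1) N.+ a) u v q
             * qfac R q k h * qfac R q k (m ∸ 2 ∸ h))
          ≈ ((u * q ^ a + v * q ^ b) * u ^ (h N.+ 1) * v ^ (m ∸ h ∸ 2)
             * q ^ (k N.* (m C 2) N.+ k N.* ((h N.+ 1) C 2) N.+ (m ∸ 1) N.* b
                    N.+ (k ∸ b N.+ a) N.* (h N.+ 1))
             * qfac R q k (m ∸ 2)))
       × ((genBD R a b k m (k N.* h N.+ k N.* (m ∸ 1) N.+ b) u v q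
             * qfac R q k h * qfac R q k (m ∸ 2 ∸ h))
          ≈ ((u * q ^ a + v * q ^ b) * u ^ h * v ^ (m ∸ h ∸ 1)
             * q ^ (k N.* (m C 2) N.+ k N.* ((h N.+ 1) C 2) N.+ (m ∸ 1) N.* b
                    N.+ (k ∸ b N.+ a) N.* h)
             * qfac R q k (m ∸ 2)))
mainTheorem18 R a b k 1≤a a<b b≤k (suc (suc _)) h (s≤s (s≤s _)) h≤m-2 u v q with ℕ.m≤n⇒∃[o]m+o≡n h≤m-2
... | j , ≡.refl = BD′[m,h,a]-gf h j , BD′[m,h,b]-gf h j
  where open GeneratingFunction R a b k 1≤a a<b b≤k u v q
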